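{- Let $n$ be even. The signed cardinality statistic $SC$ is homomesic (with orbit average $0$) under rowmotion on $\mathcal{IC}([n])$.
   Context: $[n]$ is the chain $1<\cdots<n$, ranked with the element $i$ having rank $i-1$. For $x$ in a ranked poset (ranks normalized to start at $0$), $SC(x)=1$ if the rank of $x$ is even and $-1$ if odd; for a subset $I$, $SC(I)=\sum_{x\in I}SC(x)$. A subset $I$ is interval-closed if whenever $x,y\in I$ and $x\le z\le y$, then $z\in I$; $\mathcal{IC}(P)$ is the set of interval-closed subsets. The toggle $t_x$ sends $I$ to $I\triangle\{x\}$ if this set is interval-closed, and to $I$ otherwise; rowmotion is $t_{x_1}\circ\cdots\circ t_{x_N}$ for a linear extension $(x_1,\dots,x_N)$. A statistic is homomesic if its average over each rowmotion orbit is the same for all orbits. -}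

module Defs where

open import Data.Bool using (Bool; true; false; not; if_then_else_)
open import Data.Nat as ℕ using (ℕ; zero; suc; _%_)
open import Data.Fin as Fin using (Fin; toℕ)
open import Data.Fin.Properties using (all?) renaming (_≤?_ to _≤ᶠ?_)
open import Data.Fin.Subset using (Subset; _∈_)
open import Data.Fin.Subset.Properties using (_∈?_)
open import Data.Vec using (_[_]%=_; lookup)
open import Data.List using (List; []; _∷_; allFin; foldr; map; upTo)
open import Data.Integer as ℤ using (ℤ)
open import Relation.Nullary using (Dec; yes; no; does)
open import Relation.Nullary.Decidable using (_→-dec_)
import Data.Integer.Base

-- The chain [n] = 1 < ... < n is modelled by Fin n with its usual order;
-- the element i : Fin n (i.e. the element toℕ i + 1 of [n]) has rank toℕ i.
-- Subsets of [n] are Subset n = Vec Bool n.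

IntervalClosed : {n : ℕ} → Subset n → Set
IntervalClosed {n} I =
  (x y z : Fin n) → x ∈ I → y ∈ I → x Fin.≤ z → z Fin.≤ y → z ∈ I

intervalClosed? : {n : ℕ} → (I : Subset n) → Dec (IntervalClosed I)
intervalClosed? I =
  all? λ x → all? λ y → all? λ z →
    (x ∈? I) →-dec (y ∈? I) →-dec (x ≤ᶠ? z) →-dec (z ≤ᶠ? y) →-dec (z ∈? I)

flip : {n : ℕ} → Fin n → Subset n → Subset n
flip x I = I [ x ]%= not

toggle : {n : ℕ} → Fin n → Subset n → Subset n
toggle x I with intervalClosed? (flip x I)
... | yes _ = flip x I
... | no _  = I

-- rowmotion = t_{x_1} ∘ ... ∘ t_{x_n} for the (unique) linear extension
-- (x_1, ..., x_n) = (0, 1, ..., n-1) of the chain; t_{x_n} is applied first.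
rowmotion : {n : ℕ} → Subset n → Subset n
rowmotion {n} I = foldr toggle I (allFin n)

iter : {A : Set} → (A → A) → ℕ → A → A
iter f zero    a = a
iter f (suc k) a = f (iter f k a)

sumℤ : List ℤ → ℤ
sumℤ []       = ℤ.+ 0
sumℤ (a ∷ as) = a ℤ.+ sumℤ as

SCelem : {n : ℕ} → Fin n → ℤ
SCelem x with toℕ x % 2
... | zero  = ℤ.+ 1
... | suc _ = ℤ.- (ℤ.+ 1)

SC : {n : ℕ} → Subset n → ℤ
SC {n} I = sumℤ (map (λ x → if lookup I x then SCelem x else ℤ.+ 0) (allFin n))

orbitSum : {n : ℕ} → Subset n → ℕ → ℤ
orbitSum I k = sumℤ (map (λ j → SC (iter rowmotion j I)) (upTo k))

-- An interval-closed subset of the chain is a range [a, b) of ranks.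
-- Sweeping the toggles from the top down shows that rowmotion sends [a, b) to
-- [a+1, b+1) when b < n, and [a, n) to [0, a) (the empty set being [n, n)).
-- With p i = i mod 2 one has SC [a, b) = p b - p a, and since n is even, in both
-- cases SC (row I) = - SC I.  So SC alternates in sign along an orbit, and twice
-- the orbit sum is SC I - SC (row^k I) = 0.
module Submission where

open import Data.Bool using (Bool; true; false; not; _∧_; if_then_else_)
open import Data.Bool.Properties using (T-≡; T-∧; ∧-zeroʳ)
open import Data.Empty using (⊥-elim)
open import Data.Fin as Fin using (Fin; toℕ; fromℕ<)
open import Data.Fin.Properties using (toℕ<n; toℕ-fromℕ<; toℕ-injective)
open import Data.Fin.Subset using (Subset; _∈_)
open import Data.Integer using (ℤ; +_; -_; -[1+_]; _+_; _-_)
import Data.Integer.Properties as ℤₚ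
open import Data.Integer.Tactic.RingSolver using (solve-∀)
open import Data.List as List using (applyUpTo; map; foldr; allFin)
open import Data.List.Properties using (map-tabulate; map-upTo; map-cong)
open import Data.Nat as ℕ using (ℕ; zero; suc; _<_; _≤_; _%_; _<ᵇ_; _⊓_; _⊔_; z≤n; s≤s; s≤s⁻¹; z<s)
open import Data.Nat.DivMod using (m*n%n≡0; m%n<n)
open import Data.Nat.Divisibility using (_∣_; divides)
open import Data.Nat.Properties
open import Data.Product using (_×_; _,_)
open import Data.Sum using (inj₁; inj₂)
open import Data.Vec as Vec using ([]; _∷_; lookup; there)
open import Data.Vec.Properties
  using (lookup∘tabulate; tabulate∘lookup; tabulate-cong; lookup∘updateAt; lookup∘updateAt′;
         []=⇒lookup; lookup⇒[]=)
open import Function using (_∘_; id; Equivalence)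
open import Relation.Binary.Definitions using (tri<; tri≈; tri>)
open import Relation.Binary.PropositionalEquality
open import Relation.Nullary using (¬_; yes; no; does; contradiction)
open import Relation.Nullary.Decidable using (dec-true; dec-false)

open import Defs

<ᵇ-true : ∀ {a b} → a < b → (a <ᵇ b) ≡ true
<ᵇ-true (s≤s z≤n)       = refl
<ᵇ-true (s≤s (s≤s a≤b)) = <ᵇ-true (s≤s a≤b)

<ᵇ-false : ∀ {a b} → b ≤ a → (a <ᵇ b) ≡ false
<ᵇ-false z≤n       = refl
<ᵇ-false (s≤s b≤a) = <ᵇ-false b≤a

m<ᵇ1+n≡m<ᵇn : ∀ {a b} → a ≢ b → (a <ᵇ suc b) ≡ (a <ᵇ b)
m<ᵇ1+n≡m<ᵇn {zero}  {zero}  a≢b = ⊥-elim (a≢b refl)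
m<ᵇ1+n≡m<ᵇn {zero}  {suc b} _   = refl
m<ᵇ1+n≡m<ᵇn {suc a} {zero}  _   = refl
m<ᵇ1+n≡m<ᵇn {suc a} {suc b} a≢b = m<ᵇ1+n≡m<ᵇn (a≢b ∘ cong suc)

-- Kept opaque, so that the implicit arguments of its lemmas can be inferred.
opaque
  inRange : ℕ → ℕ → ℕ → Bool
  inRange a b i = (a <ᵇ suc i) ∧ (i <ᵇ b)

  inRange-inside : ∀ {a b i} → a ≤ i → i < b → inRange a b i ≡ true
  inRange-inside a≤i i<b rewrite <ᵇ-true (s≤s a≤i) | <ᵇ-true i<b = refl

  inRange-below : ∀ {a b i} → i < a → inRange a b i ≡ false
  inRange-below i<a rewrite <ᵇ-false i<a = refl

  inRange-above : ∀ {a b i} → b ≤ i → inRange a b i ≡ false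
  inRange-above b≤i rewrite <ᵇ-false b≤i = ∧-zeroʳ _

  inRange⇒ : ∀ {a b i} → inRange a b i ≡ true → a ≤ i × i < b
  inRange⇒ {a} {b} {i} eq with Equivalence.to T-∧ (Equivalence.from T-≡ eq)
  ... | a<1+i , i<b = s≤s⁻¹ (<ᵇ⇒< a (suc i) a<1+i) , <ᵇ⇒< i b i<b

  inRange-sucˡ : ∀ {a b i} → i ≢ a → inRange (suc a) b i ≡ inRange a b i
  inRange-sucˡ {b = b} {i = i} i≢a = cong (_∧ (i <ᵇ b)) (sym (m<ᵇ1+n≡m<ᵇn (i≢a ∘ sym)))

  inRange-sucʳ : ∀ {a b i} → i ≢ b → inRange a (suc b) i ≡ inRange a b i
  inRange-sucʳ {a = a} {i = i} i≢b = cong ((a <ᵇ suc i) ∧_) (m<ᵇ1+n≡m<ᵇn i≢b)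

  inRange-suc : ∀ {a b i} → inRange (suc a) (suc b) (suc i) ≡ inRange a b i
  inRange-suc = refl

inRange-empty : ∀ {a i} → inRange a a i ≡ false
inRange-empty {a} {i} with i <? a
... | yes i<a = inRange-below i<a
... | no i≮a  = inRange-above (≮⇒≥ i≮a)

opaque
  flipAt : ℕ → (ℕ → Bool) → ℕ → Bool
  flipAt x F i = if does (i ℕ.≟ x) then not (F i) else F i

  flipAt-≡ : ∀ {x} (F : ℕ → Bool) → flipAt x F x ≡ not (F x)
  flipAt-≡ {x} F rewrite dec-true (x ℕ.≟ x) refl = refl

  flipAt-≢ : ∀ {x i} (F : ℕ → Bool) → i ≢ x → flipAt x F i ≡ F i
  flipAt-≢ {x} {i} F i≢x rewrite dec-false (i ℕ.≟ x) i≢x = refl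

flipAt-≗ : ∀ {x} {F G : ℕ → Bool} → not (F x) ≡ G x → (∀ i → i ≢ x → F i ≡ G i) →
           ∀ i → flipAt x F i ≡ G i
flipAt-≗ {x} {F} Fx≡Gx Fi≡Gi i with i ℕ.≟ x
... | yes refl = trans (flipAt-≡ F) Fx≡Gx
... | no i≢x   = trans (flipAt-≢ F i≢x) (Fi≡Gi i i≢x)

-- Subsets of Fin n are described by predicates on ranks, so that all reasoning
-- about toggles happens in ℕ.
⟦_⟧ : ∀ {n} → (ℕ → Bool) → Subset n
⟦ F ⟧ = Vec.tabulate (F ∘ toℕ)

interval : ∀ {n} → ℕ → ℕ → Subset n
interval a b = ⟦ inRange a b ⟧

⟦⟧-cong : ∀ {n} {F G : ℕ → Bool} → (∀ i → i < n → F i ≡ G i) → ⟦_⟧ {n} F ≡ ⟦ G ⟧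
⟦⟧-cong F≡G = tabulate-cong (λ x → F≡G (toℕ x) (toℕ<n x))

∈⟦⟧ : ∀ {n} (F : ℕ → Bool) (x : Fin n) → F (toℕ x) ≡ true → x ∈ ⟦ F ⟧
∈⟦⟧ F x Fx = lookup⇒[]= x _ (trans (lookup∘tabulate (F ∘ toℕ) x) Fx)

∈⟦⟧⁻ : ∀ {n} (F : ℕ → Bool) {x : Fin n} → x ∈ ⟦ F ⟧ → F (toℕ x) ≡ true
∈⟦⟧⁻ F {x} x∈ = trans (sym (lookup∘tabulate (F ∘ toℕ) x)) ([]=⇒lookup x∈)

flip-⟦⟧ : ∀ {n} {F : ℕ → Bool} (x : Fin n) → flip x ⟦ F ⟧ ≡ ⟦ flipAt (toℕ x) F ⟧
flip-⟦⟧ {F = F} x = trans (sym (tabulate∘lookup _)) (tabulate-cong lookup-flip)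
  where
  lookup-flip : ∀ i → lookup (flip x ⟦ F ⟧) i ≡ flipAt (toℕ x) F (toℕ i)
  lookup-flip i with i Fin.≟ x
  ... | yes refl = trans (lookup∘updateAt i ⟦ F ⟧)
                         (trans (cong not (lookup∘tabulate (F ∘ toℕ) i)) (sym (flipAt-≡ F)))
  ... | no i≢x   = trans (lookup∘updateAt′ i x i≢x ⟦ F ⟧)
                         (trans (lookup∘tabulate (F ∘ toℕ) i) (sym (flipAt-≢ F (i≢x ∘ toℕ-injective))))

interval-suc : ∀ {n a b} → interval {suc n} (suc a) (suc b) ≡ false ∷ interval a b
interval-suc = cong₂ _∷_ (inRange-below z<s) (⟦⟧-cong λ i _ → inRange-suc {i = i})

interval-zero : ∀ {n b} → interval {suc n} 0 (suc b) ≡ true ∷ interval 0 b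
interval-zero = cong₂ _∷_ (inRange-inside z≤n z<s)
                          (⟦⟧-cong λ i _ → trans (sym (inRange-sucˡ λ ())) (inRange-suc {i = i}))

interval-empty : ∀ {n a b} → interval {n} a a ≡ interval b b
interval-empty {a = a} {b} = ⟦⟧-cong λ i _ → trans (inRange-empty {a} {i}) (sym (inRange-empty {b} {i}))

IntervalClosed-interval : ∀ {n a b} → IntervalClosed (interval {n} a b)
IntervalClosed-interval {a = a} {b} x y z x∈ y∈ x≤z z≤y
  with inRange⇒ (∈⟦⟧⁻ (inRange a b) x∈) | inRange⇒ (∈⟦⟧⁻ (inRange a b) y∈)
... | a≤x , _ | _ , y<b = ∈⟦⟧ (inRange a b) z (inRange-inside (≤-trans a≤x x≤z) (≤-<-trans z≤y y<b))

gap⇒¬IntervalClosed : ∀ {n u z w} {F : ℕ → Bool} → u ≤ z → z ≤ w → w < n →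
                      F u ≡ true → F z ≡ false → F w ≡ true → ¬ IntervalClosed (⟦_⟧ {n} F)
gap⇒¬IntervalClosed {n} {u} {z} {w} {F} u≤z z≤w w<n Fu Fz Fw closed =
  contradiction (trans (sym Fz′) Fz) λ ()
  where
  z<n = ≤-<-trans z≤w w<n
  u<n = ≤-<-trans u≤z z<n
  fromℕ<-mono : ∀ {i j} (i<n : i < n) (j<n : j < n) → i ≤ j → fromℕ< i<n Fin.≤ fromℕ< j<n
  fromℕ<-mono i<n j<n = subst₂ _≤_ (sym (toℕ-fromℕ< i<n)) (sym (toℕ-fromℕ< j<n))
  member : ∀ {i} (i<n : i < n) → F i ≡ true → fromℕ< i<n ∈ ⟦ F ⟧
  member i<n Fi = ∈⟦⟧ F (fromℕ< i<n) (subst (λ t → F t ≡ true) (sym (toℕ-fromℕ< i<n)) Fi)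
  Fz′ : F z ≡ true
  Fz′ = subst (λ t → F t ≡ true) (toℕ-fromℕ< z<n)
          (∈⟦⟧⁻ F (closed (fromℕ< u<n) (fromℕ< w<n) (fromℕ< z<n) (member u<n Fu) (member w<n Fw)
                          (fromℕ<-mono u<n z<n u≤z) (fromℕ<-mono z<n w<n z≤w)))

IntervalClosed-tail : ∀ {n v} {J : Subset n} → IntervalClosed (v ∷ J) → IntervalClosed J
IntervalClosed-tail closed x y z x∈ y∈ x≤z z≤y
  with closed (Fin.suc x) (Fin.suc y) (Fin.suc z) (there x∈) (there y∈) (s≤s x≤z) (s≤s z≤y)
... | there z∈ = z∈

¬IntervalClosed-true∷ : ∀ {n a b} → suc a < b → b ≤ n → ¬ IntervalClosed (true ∷ interval {n} (suc a) b)
¬IntervalClosed-true∷ {a = a} {b} a<b b≤n =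
  -- true ∷ interval (suc a) b is ⟦ F ⟧ for this F by computation; 1 is the gap.
  gap⇒¬IntervalClosed {F = λ { zero → true ; (suc i) → inRange (suc a) b i }}
    (z≤n {1}) (s≤s (z≤n {suc a})) (s≤s (<-≤-trans a<b b≤n))
    refl (inRange-below z<s) (inRange-inside ≤-refl a<b)

-- The empty set is interval n n, hence an upper one.
data ChainInterval {n} : Subset n → Set where
  inner : ∀ {a b} → a < b → b < n → ChainInterval (interval a b)
  upper : ∀ {a} → a ≤ n → ChainInterval (interval a n)

ChainInterval-false∷ : ∀ {n} {J : Subset n} → ChainInterval J → ChainInterval (false ∷ J)
ChainInterval-false∷ (inner a<b b<n) = subst ChainInterval interval-suc (inner (s≤s a<b) (s≤s b<n))
ChainInterval-false∷ (upper a≤n)     = subst ChainInterval interval-suc (upper (s≤s a≤n))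

ChainInterval-true∷ : ∀ {n} {J : Subset n} → IntervalClosed (true ∷ J) → ChainInterval J → ChainInterval (true ∷ J)
ChainInterval-true∷ _      (inner {zero}  _   b<n) = subst ChainInterval interval-zero (inner z<s (s≤s b<n))
ChainInterval-true∷ closed (inner {suc _} a<b b<n) = contradiction closed (¬IntervalClosed-true∷ a<b (<⇒≤ b<n))
ChainInterval-true∷ _      (upper {zero}  _)       = subst ChainInterval interval-zero (upper z≤n)
ChainInterval-true∷ closed (upper {suc _} a≤n) with m≤n⇒m<n∨m≡n a≤n
... | inj₁ a<n  = contradiction closed (¬IntervalClosed-true∷ a<n ≤-refl)
... | inj₂ refl = subst ChainInterval (trans interval-zero (cong (true ∷_) interval-empty)) (inner z<s (s≤s z<s))

IntervalClosed⇒ChainInterval : ∀ {n} (I : Subset n) → IntervalClosed I → ChainInterval I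
IntervalClosed⇒ChainInterval []          _      = upper z≤n
IntervalClosed⇒ChainInterval (false ∷ J) closed =
  ChainInterval-false∷ (IntervalClosed⇒ChainInterval J (IntervalClosed-tail closed))
IntervalClosed⇒ChainInterval (true ∷ J)  closed =
  ChainInterval-true∷ closed (IntervalClosed⇒ChainInterval J (IntervalClosed-tail closed))

toggle-flips : ∀ {n} (x : Fin n) {I : Subset n} → IntervalClosed (flip x I) → toggle x I ≡ flip x I
toggle-flips x {I} closed with intervalClosed? (flip x I)
... | yes _      = refl
... | no ¬closed = contradiction closed ¬closed

toggle-blocked : ∀ {n} (x : Fin n) {I : Subset n} → ¬ IntervalClosed (flip x I) → toggle x I ≡ I
toggle-blocked x {I} ¬closed with intervalClosed? (flip x I)
... | yes closed = contradiction closed ¬closed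
... | no _       = refl

IntervalClosed-toggle : ∀ {n} (x : Fin n) {I : Subset n} → IntervalClosed I → IntervalClosed (toggle x I)
IntervalClosed-toggle x {I} closed with intervalClosed? (flip x I)
... | yes closed′ = closed′
... | no _        = closed

toggle-⟦⟧-interval : ∀ {n a b} (F : ℕ → Bool) (x : Fin n) → (∀ i → flipAt (toℕ x) F i ≡ inRange a b i) →
                     toggle x ⟦ F ⟧ ≡ interval a b
toggle-⟦⟧-interval {a = a} {b} F x flipped≗ =
  trans (toggle-flips x (subst IntervalClosed (sym flipped) IntervalClosed-interval)) flipped
  where
  flipped : flip x ⟦ F ⟧ ≡ interval a b
  flipped = trans (flip-⟦⟧ x) (⟦⟧-cong λ i _ → flipped≗ i)

toggle-⟦⟧-gap : ∀ {n u z w} (F : ℕ → Bool) (x : Fin n) → u ≤ z → z ≤ w → w < n →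
                flipAt (toℕ x) F u ≡ true → flipAt (toℕ x) F z ≡ false → flipAt (toℕ x) F w ≡ true →
                toggle x ⟦ F ⟧ ≡ ⟦ F ⟧
toggle-⟦⟧-gap F x u≤z z≤w w<n Fu Fz Fw = toggle-blocked x λ closed →
  gap⇒¬IntervalClosed {F = flipAt (toℕ x) F} u≤z z≤w w<n Fu Fz Fw (subst IntervalClosed (flip-⟦⟧ x) closed)

module _ {n} (x : Fin n) where

  private c = toℕ x

  toggle-extendʳ : ∀ {a} → a ≤ c → toggle x (interval a c) ≡ interval a (suc c)
  toggle-extendʳ {a} a≤c = toggle-⟦⟧-interval (inRange a c) x (flipAt-≗
    (trans (cong not (inRange-above ≤-refl)) (sym (inRange-inside a≤c (n<1+n c))))
    (λ i i≢c → sym (inRange-sucʳ i≢c)))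

  toggle-shrinkʳ : ∀ {a} → a ≤ c → toggle x (interval a (suc c)) ≡ interval a c
  toggle-shrinkʳ {a} a≤c = toggle-⟦⟧-interval (inRange a (suc c)) x (flipAt-≗
    (trans (cong not (inRange-inside a≤c (n<1+n c))) (sym (inRange-above ≤-refl)))
    (λ i i≢c → inRange-sucʳ i≢c))

  toggle-shrinkˡ : ∀ {b} → c < b → toggle x (interval c b) ≡ interval (suc c) b
  toggle-shrinkˡ {b} c<b = toggle-⟦⟧-interval (inRange c b) x (flipAt-≗
    (trans (cong not (inRange-inside ≤-refl c<b)) (sym (inRange-below (n<1+n c))))
    (λ i i≢c → sym (inRange-sucˡ i≢c)))

  toggle-extendˡ : ∀ {b} → c < b → toggle x (interval (suc c) b) ≡ interval c b
  toggle-extendˡ {b} c<b = toggle-⟦⟧-interval (inRange (suc c) b) x (flipAt-≗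
    (trans (cong not (inRange-below (n<1+n c))) (sym (inRange-inside ≤-refl c<b)))
    (λ i i≢c → inRange-sucˡ i≢c))

  toggle-inside : ∀ {a b} → a < c → suc c < b → b ≤ n → toggle x (interval a b) ≡ interval a b
  toggle-inside {a} {b} a<c 1+c<b b≤n =
    toggle-⟦⟧-gap (inRange a b) x (<⇒≤ a<c) (n≤1+n c) (<-≤-trans 1+c<b b≤n)
      (trans (flipAt-≢ (inRange a b) (<⇒≢ a<c)) (inRange-inside ≤-refl (<-trans a<c c<b)))
      (trans (flipAt-≡ (inRange a b)) (cong not (inRange-inside (<⇒≤ a<c) c<b)))
      (trans (flipAt-≢ (inRange a b) 1+n≢n) (inRange-inside (≤-trans (<⇒≤ a<c) (n≤1+n c)) 1+c<b))
    where c<b = <-trans (n<1+n c) 1+c<b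

  toggle-above : ∀ {a b} → a < b → b < c → toggle x (interval a b) ≡ interval a b
  toggle-above {a} {b} a<b b<c =
    toggle-⟦⟧-gap (inRange a b) x (<⇒≤ a<b) (<⇒≤ b<c) (toℕ<n x)
      (trans (flipAt-≢ (inRange a b) (<⇒≢ (<-trans a<b b<c))) (inRange-inside ≤-refl a<b))
      (trans (flipAt-≢ (inRange a b) (<⇒≢ b<c)) (inRange-above ≤-refl))
      (trans (flipAt-≡ (inRange a b)) (cong not (inRange-above (<⇒≤ b<c))))

  toggle-below : ∀ {a b} → suc c < a → a < b → b ≤ n → toggle x (interval a b) ≡ interval a b
  toggle-below {a} {b} 1+c<a a<b b≤n =
    toggle-⟦⟧-gap (inRange a b) x (n≤1+n c) (<⇒≤ 1+c<a) (<-≤-trans a<b b≤n)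
      (trans (flipAt-≡ (inRange a b)) (cong not (inRange-below c<a)))
      (trans (flipAt-≢ (inRange a b) 1+n≢n) (inRange-below 1+c<a))
      (trans (flipAt-≢ (inRange a b) (>⇒≢ c<a)) (inRange-inside ≤-refl a<b))
    where c<a = <-trans (n<1+n c) 1+c<a

-- Rowmotion toggles n-1, n-2, ..., 0 in turn; state c is the subset reached just
-- after the toggle at c.
foldr-toggle-sweep : ∀ {n} (state : ℕ → Subset n) →
                     (∀ x → toggle x (state (suc (toℕ x))) ≡ state (toℕ x)) →
                     ∀ {m} c (f : Fin m → Fin n) → (∀ i → toℕ (f i) ≡ c ℕ.+ toℕ i) →
                     foldr toggle (state (c ℕ.+ m)) (List.tabulate f) ≡ state c
foldr-toggle-sweep state step {zero}  c f _  = cong state (+-identityʳ c)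
foldr-toggle-sweep state step {suc m} c f f≡ rewrite +-suc c m =
  trans (cong (toggle (f Fin.zero)) (foldr-toggle-sweep state step (suc c) (f ∘ Fin.suc) f∘suc≡))
        (subst (λ k → toggle (f Fin.zero) (state (suc k)) ≡ state k) f0≡c (step (f Fin.zero)))
  where
  f0≡c = trans (f≡ Fin.zero) (+-identityʳ c)
  f∘suc≡ = λ i → trans (f≡ (Fin.suc i)) (+-suc c (toℕ i))

rowmotion-sweep : ∀ {n} (state : ℕ → Subset n) → (∀ x → toggle x (state (suc (toℕ x))) ≡ state (toℕ x)) →
                  rowmotion (state n) ≡ state 0
rowmotion-sweep state step = foldr-toggle-sweep state step 0 id (λ _ → refl)

rowmotion-upper : ∀ {n a} → a ≤ n → rowmotion (interval {n} a n) ≡ interval 0 a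
rowmotion-upper {n} {a} a≤n = begin
  rowmotion (interval a n) ≡⟨ cong rowmotion (cong₂ interval (m≤n⇒m⊓n≡m a≤n) (m≤n⇒m⊔n≡n a≤n)) ⟨
  rowmotion (sweep n)      ≡⟨ rowmotion-sweep sweep step ⟩
  sweep 0                  ≡⟨ cong₂ interval (⊓-zeroʳ a) (⊔-identityʳ a) ⟩
  interval 0 a             ∎
  where
  open ≡-Reasoning
  sweep : ℕ → Subset n
  sweep c = interval (a ⊓ c) (a ⊔ c)
  step : ∀ x → toggle x (sweep (suc (toℕ x))) ≡ sweep (toℕ x)
  step x with a ≤? toℕ x
  ... | yes a≤c rewrite m≤n⇒m⊓n≡m a≤c | m≤n⇒m⊔n≡n a≤c
                      | m≤n⇒m⊓n≡m (m≤n⇒m≤1+n a≤c) | m≤n⇒m⊔n≡n (m≤n⇒m≤1+n a≤c)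
                      = toggle-shrinkʳ x a≤c
  ... | no a≰c  rewrite m≥n⇒m⊓n≡n (≰⇒> a≰c) | m≥n⇒m⊔n≡m (≰⇒> a≰c)
                      | m≥n⇒m⊓n≡n (<⇒≤ (≰⇒> a≰c)) | m≥n⇒m⊔n≡m (<⇒≤ (≰⇒> a≰c))
                      = toggle-extendˡ x (≰⇒> a≰c)

bump : ℕ → ℕ → ℕ
bump c a = if c <ᵇ suc a then suc a else a

bump-≤ : ∀ {c a} → c ≤ a → bump c a ≡ suc a
bump-≤ c≤a rewrite <ᵇ-true (s≤s c≤a) = refl

bump-> : ∀ {c a} → a < c → bump c a ≡ a
bump-> a<c rewrite <ᵇ-false a<c = refl

-- From [a, b) with b < n, the toggle at b adds b, the toggle at a removes a, and
-- all other toggles are blocked.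
innerSweep : ∀ {n} → ℕ → ℕ → ℕ → Subset n
innerSweep a b c = interval (bump c a) (bump c b)

innerSweep-step : ∀ {n a b} → a < b → b < n → (x : Fin n) →
                  toggle x (innerSweep a b (suc (toℕ x))) ≡ innerSweep a b (toℕ x)
innerSweep-step {a = a} {b} a<b b<n x with <-cmp (toℕ x) a
... | tri< c<a _ _
  rewrite bump-≤ c<a | bump-≤ (<⇒≤ c<a) | bump-≤ (<-trans c<a a<b) | bump-≤ (<⇒≤ (<-trans c<a a<b))
  = toggle-below x (s≤s c<a) (s≤s a<b) b<n
... | tri≈ _ refl _
  rewrite bump-> (n<1+n (toℕ x)) | bump-≤ (≤-refl {toℕ x}) | bump-≤ a<b | bump-≤ (<⇒≤ a<b)
  = toggle-shrinkˡ x (m<n⇒m<1+n a<b)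
... | tri> _ _ a<c with <-cmp (toℕ x) b
...   | tri< c<b _ _
  rewrite bump-> (m<n⇒m<1+n a<c) | bump-> a<c | bump-≤ c<b | bump-≤ (<⇒≤ c<b)
  = toggle-inside x a<c (s≤s c<b) b<n
...   | tri≈ _ refl _
  rewrite bump-> (m<n⇒m<1+n a<c) | bump-> a<c | bump-> (n<1+n (toℕ x)) | bump-≤ (≤-refl {toℕ x})
  = toggle-extendʳ x (<⇒≤ a<b)
...   | tri> _ _ b<c
  rewrite bump-> (m<n⇒m<1+n a<c) | bump-> a<c | bump-> (m<n⇒m<1+n b<c) | bump-> b<c
  = toggle-above x a<b b<c

rowmotion-inner : ∀ {n a b} → a < b → b < n → rowmotion (interval {n} a b) ≡ interval (suc a) (suc b)
rowmotion-inner {n} {a} {b} a<b b<n = begin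
  rowmotion (interval a b)     ≡⟨ cong rowmotion (cong₂ interval (bump-> (<-trans a<b b<n)) (bump-> b<n)) ⟨
  rowmotion (innerSweep a b n) ≡⟨ rowmotion-sweep (innerSweep a b) (innerSweep-step a<b b<n) ⟩
  interval (suc a) (suc b)     ∎
  where open ≡-Reasoning

IntervalClosed-foldr-toggle : ∀ {n} (L : List.List (Fin n)) {I : Subset n} →
                              IntervalClosed I → IntervalClosed (foldr toggle I L)
IntervalClosed-foldr-toggle List.[]      closed = closed
IntervalClosed-foldr-toggle (x List.∷ L) closed = IntervalClosed-toggle x (IntervalClosed-foldr-toggle L closed)

IntervalClosed-iter-rowmotion : ∀ {n} j {I : Subset n} → IntervalClosed I → IntervalClosed (iter rowmotion j I)
IntervalClosed-iter-rowmotion zero    closed = closed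
IntervalClosed-iter-rowmotion (suc j) closed =
  IntervalClosed-foldr-toggle (allFin _) (IntervalClosed-iter-rowmotion j closed)

parity : ℕ → ℤ
parity i = + (i % 2)

parity-suc : ∀ i → parity (suc i) ≡ + 1 - parity i
parity-suc zero          = refl
parity-suc (suc zero)    = refl
parity-suc (suc (suc i)) = parity-suc i

parity-even : ∀ {n} → 2 ∣ n → parity n ≡ + 0
parity-even (divides q refl) = cong +_ (m*n%n≡0 q 2)

SCelem≡parity : ∀ {n} (x : Fin n) → SCelem x ≡ parity (suc (toℕ x)) - parity (toℕ x)
SCelem≡parity x rewrite parity-suc (toℕ x) with toℕ x % 2 | m%n<n (toℕ x) 2
... | zero        | _ = refl
... | suc zero    | _ = refl
... | suc (suc _) | s≤s (s≤s ())

[y-x]+[z-y]≡z-x : ∀ x y z → (y - x) + (z - y) ≡ z - x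
[y-x]+[z-y]≡z-x = solve-∀

sum-telescope : ∀ m (u : ℕ → ℤ) →
                sumℤ (List.tabulate {n = m} (λ i → u (suc (toℕ i)) - u (toℕ i))) ≡ u m - u 0
sum-telescope zero    u = sym (ℤₚ.+-inverseʳ (u 0))
sum-telescope (suc m) u =
  trans (cong (_+_ (u 1 - u 0)) (sum-telescope m (u ∘ suc))) ([y-x]+[z-y]≡z-x (u 0) (u 1) (u (suc m)))

clamp : ℕ → ℕ → ℕ → ℕ
clamp a b i = a ⊔ (i ⊓ b)

clamp-below : ∀ {a b i} → i ≤ a → a ≤ b → clamp a b i ≡ a
clamp-below i≤a a≤b rewrite m≤n⇒m⊓n≡m (≤-trans i≤a a≤b) = m≥n⇒m⊔n≡m i≤a

clamp-inside : ∀ {a b i} → a ≤ i → i ≤ b → clamp a b i ≡ i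
clamp-inside a≤i i≤b rewrite m≤n⇒m⊓n≡m i≤b = m≤n⇒m⊔n≡n a≤i

clamp-above : ∀ {a b i} → a ≤ b → b ≤ i → clamp a b i ≡ b
clamp-above a≤b b≤i rewrite m≥n⇒m⊓n≡n b≤i = m≤n⇒m⊔n≡n a≤b

inRange-telescopes : ∀ {a b} → a ≤ b → (u : ℕ → ℤ) (i : ℕ) →
                     (if inRange a b i then u (suc i) - u i else + 0) ≡ u (clamp a b (suc i)) - u (clamp a b i)
inRange-telescopes {a} {b} a≤b u i with i <? a | i <? b
... | yes i<a | _
  rewrite inRange-below {b = b} i<a | clamp-below i<a a≤b | clamp-below (<⇒≤ i<a) a≤b
  = sym (ℤₚ.+-inverseʳ (u a))
... | no i≮a | yes i<b
  rewrite inRange-inside (≮⇒≥ i≮a) i<b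
        | clamp-inside (m≤n⇒m≤1+n (≮⇒≥ i≮a)) i<b | clamp-inside (≮⇒≥ i≮a) (<⇒≤ i<b)
  = refl
... | no _ | no i≮b
  rewrite inRange-above {a = a} (≮⇒≥ i≮b)
        | clamp-above a≤b (m≤n⇒m≤1+n (≮⇒≥ i≮b)) | clamp-above a≤b (≮⇒≥ i≮b)
  = sym (ℤₚ.+-inverseʳ (u b))

SC-interval : ∀ {n a b} → a ≤ b → b ≤ n → SC (interval {n} a b) ≡ parity b - parity a
SC-interval {n} {a} {b} a≤b b≤n = begin
  SC (interval {n} a b)            ≡⟨ cong sumℤ (map-cong term (allFin n)) ⟩
  sumℤ (map telescoped (allFin n)) ≡⟨ cong sumℤ (map-tabulate id telescoped) ⟩
  sumℤ (List.tabulate telescoped)  ≡⟨ sum-telescope n u ⟩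
  u n - u 0                        ≡⟨ cong₂ (λ p q → parity p - parity q)
                                            (clamp-above a≤b b≤n) (clamp-below z≤n a≤b) ⟩
  parity b - parity a              ∎
  where
  open ≡-Reasoning
  u : ℕ → ℤ
  u = parity ∘ clamp a b
  telescoped : Fin n → ℤ
  telescoped x = u (suc (toℕ x)) - u (toℕ x)
  term : ∀ x → (if lookup (interval {n} a b) x then SCelem x else + 0) ≡ telescoped x
  term x = trans (cong₂ (λ m s → if m then s else + 0) (lookup∘tabulate _ x) (SCelem≡parity x))
                 (inRange-telescopes a≤b parity (toℕ x))

[1-q]-[1-p]≡-[q-p] : ∀ p q → (+ 1 - q) - (+ 1 - p) ≡ - (q - p)
[1-q]-[1-p]≡-[q-p] = solve-∀

p-0≡-[0-p] : ∀ p → p - + 0 ≡ - (+ 0 - p)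
p-0≡-[0-p] = solve-∀

SC-rowmotion : ∀ {n} → 2 ∣ n → {I : Subset n} → IntervalClosed I → SC (rowmotion I) ≡ - SC I
SC-rowmotion {n} 2∣n {I} closed with IntervalClosed⇒ChainInterval I closed
... | inner {a} {b} a<b b<n = begin
  SC (rowmotion (interval {n} a b))   ≡⟨ cong SC (rowmotion-inner a<b b<n) ⟩
  SC (interval {n} (suc a) (suc b))   ≡⟨ SC-interval (s≤s (<⇒≤ a<b)) b<n ⟩
  parity (suc b) - parity (suc a)     ≡⟨ cong₂ _-_ (parity-suc b) (parity-suc a) ⟩
  (+ 1 - parity b) - (+ 1 - parity a) ≡⟨ [1-q]-[1-p]≡-[q-p] (parity a) (parity b) ⟩
  - (parity b - parity a)             ≡⟨ cong -_ (SC-interval (<⇒≤ a<b) (<⇒≤ b<n)) ⟨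
  - SC (interval {n} a b)             ∎
  where open ≡-Reasoning
... | upper {a} a≤n = begin
  SC (rowmotion (interval {n} a n))   ≡⟨ cong SC (rowmotion-upper a≤n) ⟩
  SC (interval {n} 0 a)               ≡⟨ SC-interval z≤n a≤n ⟩
  parity a - + 0                      ≡⟨ p-0≡-[0-p] (parity a) ⟩
  - (+ 0 - parity a)                  ≡⟨ cong (λ p → - (p - parity a)) (parity-even 2∣n) ⟨
  - (parity n - parity a)             ≡⟨ cong -_ (SC-interval a≤n ≤-refl) ⟨
  - SC (interval {n} a n)             ∎
  where open ≡-Reasoning

[x+s]+[x+s]≡[x+x]+[s+s] : ∀ x s → (x + s) + (x + s) ≡ (x + x) + (s + s)
[x+s]+[x+s]≡[x+x]+[s+s] = solve-∀

[x+x]+[-x-y]≡x-y : ∀ x y → (x + x) + (- x - y) ≡ x - y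
[x+x]+[-x-y]≡x-y = solve-∀

sum-alternating : (s : ℕ → ℤ) → (∀ j → s (suc j) ≡ - s j) → ∀ k →
                  sumℤ (applyUpTo s k) + sumℤ (applyUpTo s k) ≡ s 0 - s k
sum-alternating s _   zero    = sym (ℤₚ.+-inverseʳ (s 0))
sum-alternating s alt (suc k) = begin
  (s 0 + S) + (s 0 + S)             ≡⟨ [x+s]+[x+s]≡[x+x]+[s+s] (s 0) S ⟩
  (s 0 + s 0) + (S + S)             ≡⟨ cong (_+_ (s 0 + s 0)) (sum-alternating (s ∘ suc) (alt ∘ suc) k) ⟩
  (s 0 + s 0) + (s 1 - s (suc k))   ≡⟨ cong (λ t → (s 0 + s 0) + (t - s (suc k))) (alt 0) ⟩
  (s 0 + s 0) + (- s 0 - s (suc k)) ≡⟨ [x+x]+[-x-y]≡x-y (s 0) (s (suc k)) ⟩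
  s 0 - s (suc k)                   ∎
  where
  open ≡-Reasoning
  S = sumℤ (applyUpTo (s ∘ suc) k)

x+x≡0⇒x≡0 : ∀ {x} → x + x ≡ + 0 → x ≡ + 0
x+x≡0⇒x≡0 {+ zero}    _ = refl
x+x≡0⇒x≡0 {+ suc _}   ()
x+x≡0⇒x≡0 { -[1+ _ ]} ()

sum-alternating-periodic : (s : ℕ → ℤ) → (∀ j → s (suc j) ≡ - s j) → ∀ k → s k ≡ s 0 →
                           sumℤ (applyUpTo s k) ≡ + 0
sum-alternating-periodic s alt k period =
  x+x≡0⇒x≡0 (trans (sum-alternating s alt k) (trans (cong (_-_ (s 0)) period) (ℤₚ.+-inverseʳ (s 0))))

proposition3p18 : (n : ℕ) → 2 ∣ n →
    (I : Subset n) → IntervalClosed I →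
    (k : ℕ) → 0 < k → iter rowmotion k I ≡ I →
    ((j : ℕ) → 0 < j → j < k → iter rowmotion j I ≢ I) →
    orbitSum I k ≡ + 0
proposition3p18 n 2∣n I closed k _ period _ = begin
  orbitSum I k         ≡⟨ cong sumℤ (map-upTo s k) ⟩
  sumℤ (applyUpTo s k) ≡⟨ sum-alternating-periodic s alternates k (cong SC period) ⟩
  + 0                  ∎
  where
  open ≡-Reasoning
  s : ℕ → ℤ
  s j = SC (iter rowmotion j I)
  alternates : ∀ j → s (suc j) ≡ - s j
  alternates j = SC-rowmotion 2∣n (IntervalClosed-iter-rowmotion j closed)
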